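{- Let $\Gamma$ be a doubly regular $(m,r)$-team semicomplete multipartite digraph with partite sets $V_1,\dots,V_m$, and let $(i,j)$ be a pair with $i\neq j$. Then one of the following holds: (i) $|A_j^+(x)|$ takes the same value for every $x\in V_i$; (ii) $V_i$ is partitioned into two nonempty sets $V_i=V_i'\cup V_i''$ such that $(V_i'\times V_j)\cup(V_j\times V_i'')\subseteq A\vec\Gamma$; (iii) $V_i$ and $V_j$ are partitioned into nonempty sets $V_i=V_i'\cup V_i''$ and $V_j=V_j'\cup V_j''$ such that $(V_i'\times V_j')\cup(V_i''\times V_j'')\subseteq E\Gamma$ and $(V_i'\times V_j'')\cup(V_j'\times V_i'')\subseteq A\vec\Gamma$, where $|V_j''|=\frac r2$.
   Context: A digraph has vertex set $V\Gamma$ and arcs $A\Gamma$ (ordered pairs of distinct vertices); its underlying graph joins $x,y$ iff $(x,y)$ or $(y,x)$ is an arc. An $(m,r)$-team semicomplete multipartite digraph ($m,r\geq2$) is a digraph whose underlying graph is the complete multipartite graph with $m$ parts $V_1,\dots,V_m$ each of size $r$. Let $E\Gamma=\{(x,y):(x,y),(y,x)\in A\Gamma\}$, $\vec\Gamma=(V\Gamma,A\Gamma\setminus E\Gamma)$, $A_0,A_1$ the adjacency matrices of $(V\Gamma,E\Gamma)$ and $\vec\Gamma$. A regular such $\Gamma$ is doubly regular if there exist integers $t,\alpha_s,\beta_s,\gamma_s,\eta_s$ ($s=0,1,2$) with $A_iA_j=t\delta_{0,i+j}I+\alpha_{i+j}A_1+\beta_{i+j}A_1^{\top}+\gamma_{i+j}A_0+\eta_{i+j}(J-I-A_1-A_1^{\top}-A_0)$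 for all $i,j\in\{0,1\}$. For $x\in V_i$ and $j\neq i$, $A_j^+(x)=\{y\in V_j:(x,y)\in A\vec\Gamma\}$. -}

module Defs where

open import Data.Nat using (ℕ; zero; suc; _+_; _*_; _≤_)
open import Data.Integer using (ℤ; +_) renaming (_+_ to _+ℤ_; _*_ to _*ℤ_)
open import Data.Fin using (Fin; zero; suc) renaming (_≟_ to _≟F_)
open import Data.Bool using (Bool; true; false; _∧_; _∨_; not; if_then_else_)
open import Data.Product using (_×_; _,_; proj₁; proj₂; ∃; ∃-syntax; Σ)
open import Data.Sum using (_⊎_)
open import Relation.Nullary.Decidable using (⌊_⌋)
open import Relation.Binary.PropositionalEquality using (_≡_; _≢_)

count : ∀ n → (Fin n → Bool) → ℕ
count zero    p = 0
count (suc n) p = (if p zero then 1 else 0) + count n (λ k → p (suc k))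

sumF : ∀ n → (Fin n → ℕ) → ℕ
sumF zero    f = 0
sumF (suc n) f = f zero + sumF n (λ k → f (suc k))

-- Vertex set of an (m,r)-team multipartite digraph: vertex (i , a) is the
-- a-th vertex of the partite set V_i.
Vtx : ℕ → ℕ → Set
Vtx m r = Fin m × Fin r

countV : ∀ m r → (Vtx m r → Bool) → ℕ
countV m r p = sumF m (λ i → count r (λ a → p (i , a)))

_≟V_ : ∀ {m r} → Vtx m r → Vtx m r → Bool
(i , a) ≟V (j , b) = ⌊ i ≟F j ⌋ ∧ ⌊ a ≟F b ⌋

Digraph : ℕ → ℕ → Set
Digraph m r = Vtx m r → Vtx m r → Bool

IsTeamSMD : ∀ m r → Digraph m r → Set
IsTeamSMD m r arc =
  (2 ≤ m) × (2 ≤ r) ×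
  (∀ (x y : Vtx m r) → proj₁ x ≡ proj₁ y → arc x y ≡ false) ×
  (∀ (x y : Vtx m r) → proj₁ x ≢ proj₁ y → (arc x y ∨ arc y x) ≡ true)

module _ {m r : ℕ} (arc : Digraph m r) where

  Ed : Vtx m r → Vtx m r → Bool
  Ed x y = arc x y ∧ arc y x

  Ar : Vtx m r → Vtx m r → Bool
  Ar x y = arc x y ∧ not (arc y x)

  -- the matrix J - I - A1 - A1ᵀ - A0
  Rest : Vtx m r → Vtx m r → Bool
  Rest x y = not (x ≟V y) ∧ not (arc x y) ∧ not (arc y x)

  Adj : Fin 2 → Vtx m r → Vtx m r → Bool
  Adj zero    = Ed
  Adj (suc _) = Ar

  prod : Fin 2 → Fin 2 → Vtx m r → Vtx m r → ℕ
  prod i j x y = countV m r (λ z → Adj i x z ∧ Adj j z y)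

  IsRegular : Set
  IsRegular = ∃[ k ] (∀ x → countV m r (λ y → arc x y) ≡ k)
                   × (∀ x → countV m r (λ y → arc y x) ≡ k)

  b2z : Bool → ℤ
  b2z true  = + 1
  b2z false = + 0

  idx : Fin 2 → Fin 2 → Fin 3
  idx zero    zero    = zero
  idx zero    (suc _) = suc zero
  idx (suc _) zero    = suc zero
  idx (suc _) (suc _) = suc (suc zero)

  δ0 : Fin 2 → Fin 2 → Bool
  δ0 zero zero = true
  δ0 _    _    = false

  IsDoublyRegular : Set
  IsDoublyRegular =
    IsRegular ×
    Σ ℤ λ t → Σ (Fin 3 → ℤ) λ α → Σ (Fin 3 → ℤ) λ β →
    Σ (Fin 3 → ℤ) λ γ → Σ (Fin 3 → ℤ) λ η →
      ∀ (i j : Fin 2) (x y : Vtx m r) →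
        + (prod i j x y) ≡
          (t *ℤ b2z (δ0 i j ∧ (x ≟V y)))
          +ℤ (α (idx i j) *ℤ b2z (Ar x y))
          +ℤ (β (idx i j) *ℤ b2z (Ar y x))
          +ℤ (γ (idx i j) *ℤ b2z (Ed x y))
          +ℤ (η (idx i j) *ℤ b2z (Rest x y))

  outTo : Vtx m r → Fin m → ℕ
  outTo x j = count r (λ b → Ar x (j , b))

  -- the three alternatives for the pair (i , j)
  -- A subset of V_i is encoded by a predicate S : Fin r → Bool
  -- (V_i' = {a | S a ≡ true}, V_i'' = {a | S a ≡ false}).
  Alt1 : Fin m → Fin m → Set
  Alt1 i j = ∃[ c ] (∀ (a : Fin r) → outTo (i , a) j ≡ c)

  Alt2 : Fin m → Fin m → Set
  Alt2 i j = Σ (Fin r → Bool) λ S →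
    (∃[ a ] S a ≡ true) × (∃[ a ] S a ≡ false) ×
    (∀ a b → S a ≡ true  → Ar (i , a) (j , b) ≡ true) ×
    (∀ a b → S a ≡ false → Ar (j , b) (i , a) ≡ true)

  Alt3 : Fin m → Fin m → Set
  Alt3 i j = Σ (Fin r → Bool) λ S → Σ (Fin r → Bool) λ T →
    (∃[ a ] S a ≡ true) × (∃[ a ] S a ≡ false) ×
    (∃[ b ] T b ≡ true) × (∃[ b ] T b ≡ false) ×
    (∀ a b → S a ≡ true  → T b ≡ true  → Ed (i , a) (j , b) ≡ true) ×
    (∀ a b → S a ≡ false → T b ≡ false → Ed (i , a) (j , b) ≡ true) ×
    (∀ a b → S a ≡ true  → T b ≡ false → Ar (i , a) (j , b) ≡ true) ×
    (∀ a b → T b ≡ true  → S a ≡ false → Ar (j , b) (i , a) ≡ true) ×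
    (2 * count r (λ b → not (T b)) ≡ r)

-- For x ∈ V_i and y ∈ V_j, sort the out-neighbours z of x in Γ⃗ by how z
-- relates to y (z ∈ V_j, z → y, z ↔ y, y → z).  This writes the out-degree
-- of x in Γ⃗ as |A_j^+(x)| + (A₁A₁ + A₁A₀)(x,y) + #{common out-neighbours}.
-- Regularity makes that out-degree constant and double regularity makes
-- (A₁A₁ + A₁A₀)(x,y) depend only on the orientation of xy, so
-- |A_j^+(x)| − |A_i^+(y)| = σ(x,y)·δ for a constant δ, where σ = 1, −1, 0
-- for x → y, y → x, x ↔ y.  The same count for mutual neighbours shows that
-- all x ∈ V_i have equally many mutual neighbours in V_j.
-- If |A_j^+| is not constant on V_i, then δ ≠ 0 and the {−1,0,1}-matrix
-- σ on V_i × V_j has the form f(a) − g(b), so any two of its rows differ by a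
-- constant.  With the same number of zeros in every row, either all rows
-- are constant 1 or −1 (case (ii)), or there are just two distinct rows,
-- one step apart, with complementary zero patterns of size r/2 (case (iii)).
module Submission where

open import Defs
open import Data.Nat using (ℕ)
open import Data.Fin using (Fin)
open import Data.Sum using (_⊎_)
open import Relation.Binary.PropositionalEquality using (_≢_)

open import Data.Nat using (zero; suc; _+_; _*_)
import Data.Nat.Properties as ℕ
open import Data.Nat.Tactic.RingSolver using (solve-∀)
open import Algebra.Properties.CommutativeSemigroup ℕ.+-commutativeSemigroup
  using (interchange)
open import Data.Integer using (ℤ; 0ℤ; 1ℤ; -1ℤ; ≢-nonZero)
  renaming (+_ to pos; _+_ to _+ℤ_; _*_ to _*ℤ_; _-_ to _-ℤ_)
import Data.Integer.Properties as ℤ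
open import Data.Integer.Tactic.RingSolver renaming (solve-∀ to solve-∀ℤ)
open import Data.Fin using (zero; suc) renaming (_≟_ to _≟F_)
open import Data.Fin.Patterns using (0F; 1F)
open import Data.Fin.Properties using (¬Fin0; all?; ¬∀⟶∃¬; suc-injective)
open import Data.Bool using (Bool; true; false; _∧_; _∨_; not; if_then_else_)
import Data.Bool.Properties as Bool
open import Data.Product using (_×_; _,_; proj₁; proj₂; ∃-syntax; ∃₂; Σ)
open import Data.Sum using (inj₁; inj₂)
import Data.Sum as Sum
open import Data.Empty using (⊥-elim)
open import Function using (_∘_)
open import Relation.Nullary using (¬_; Dec; yes; no)
open import Relation.Nullary.Decidable using (⌊_⌋)
open import Relation.Binary.PropositionalEquality
  using (_≡_; refl; sym; trans; cong; cong₂; subst; subst₂; module ≡-Reasoning)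
open ≡-Reasoning

ind : Bool → ℕ
ind b = if b then 1 else 0

count-cong : ∀ n {p q : Fin n → Bool} → (∀ k → p k ≡ q k) → count n p ≡ count n q
count-cong zero    _   = refl
count-cong (suc n) p≗q = cong₂ _+_ (cong ind (p≗q zero)) (count-cong n (p≗q ∘ suc))

count-complement : ∀ n (p : Fin n → Bool) → count n p + count n (not ∘ p) ≡ n
count-complement zero    p = refl
count-complement (suc n) p with p zero
... | true  = cong suc (count-complement n (p ∘ suc))
... | false = trans (ℕ.+-suc _ _) (cong suc (count-complement n (p ∘ suc)))

all-false⇒count≡0 : ∀ n (p : Fin n → Bool) → (∀ k → p k ≡ false) → count n p ≡ 0
all-false⇒count≡0 zero    p _     = refl
all-false⇒count≡0 (suc n) p p≡f = cong₂ _+_ (cong ind (p≡f zero)) (all-false⇒count≡0 n (p ∘ suc) (p≡f ∘ suc))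

count≡0⇒false : ∀ n (p : Fin n → Bool) → count n p ≡ 0 → ∀ k → p k ≡ false
count≡0⇒false (suc n) p c≡0 zero with p zero
... | false = refl
count≡0⇒false (suc n) p c≡0 (suc k) = count≡0⇒false n (p ∘ suc) (ℕ.m+n≡0⇒n≡0 (ind (p zero)) c≡0) k

count≢0⇒∃ : ∀ n (p : Fin n → Bool) → count n p ≢ 0 → ∃[ k ] p k ≡ true
count≢0⇒∃ zero    p c≢0 = ⊥-elim (c≢0 refl)
count≢0⇒∃ (suc n) p c≢0 with p zero in p₀
... | true  = zero , p₀
... | false = let k , pk = count≢0⇒∃ n (p ∘ suc) c≢0 in suc k , pk

sumF-cong : ∀ n {f g : Fin n → ℕ} → (∀ k → f k ≡ g k) → sumF n f ≡ sumF n g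
sumF-cong zero    _   = refl
sumF-cong (suc n) f≗g = cong₂ _+_ (f≗g zero) (sumF-cong n (f≗g ∘ suc))

sumF-+ : ∀ n (f g : Fin n → ℕ) → sumF n (λ k → f k + g k) ≡ sumF n f + sumF n g
sumF-+ zero    f g = refl
sumF-+ (suc n) f g = trans (cong ((f zero + g zero) +_) (sumF-+ n (f ∘ suc) (g ∘ suc)))
                           (interchange (f zero) (g zero) _ _)

sumF-zero : ∀ n (f : Fin n → ℕ) → (∀ k → f k ≡ 0) → sumF n f ≡ 0
sumF-zero zero    f _   = refl
sumF-zero (suc n) f f≡0 = cong₂ _+_ (f≡0 zero) (sumF-zero n (f ∘ suc) (f≡0 ∘ suc))

sumF-supported : ∀ n (j : Fin n) (f : Fin n → ℕ) → (∀ k → k ≢ j → f k ≡ 0) → sumF n f ≡ f j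
sumF-supported (suc n) zero    f f≡0 =
  trans (cong (f zero +_) (sumF-zero n (f ∘ suc) (λ k → f≡0 (suc k) (λ ()))))
        (ℕ.+-identityʳ (f zero))
sumF-supported (suc n) (suc j) f f≡0 =
  trans (cong (_+ sumF n (f ∘ suc)) (f≡0 zero (λ ())))
        (sumF-supported n j (f ∘ suc) (λ k k≢j → f≡0 (suc k) (k≢j ∘ suc-injective)))

module _ {m r : ℕ} where

  sumV : (Vtx m r → ℕ) → ℕ
  sumV f = sumF m (λ i → sumF r (λ a → f (i , a)))

  countV≡sumV : ∀ (p : Vtx m r → Bool) → countV m r p ≡ sumV (ind ∘ p)
  countV≡sumV p = sumF-cong m (λ i → count≡sumF r (λ a → p (i , a)))
    where
      count≡sumF : ∀ n (p : Fin n → Bool) → count n p ≡ sumF n (ind ∘ p)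
      count≡sumF zero    p = refl
      count≡sumF (suc n) p = cong (ind (p zero) +_) (count≡sumF n (p ∘ suc))

  sumV-cong : ∀ {f g : Vtx m r → ℕ} → (∀ z → f z ≡ g z) → sumV f ≡ sumV g
  sumV-cong f≗g = sumF-cong m (λ i → sumF-cong r (λ a → f≗g (i , a)))

  sumV-+ : ∀ (f g : Vtx m r → ℕ) → sumV (λ z → f z + g z) ≡ sumV f + sumV g
  sumV-+ f g = trans (sumF-cong m (λ i → sumF-+ r _ _)) (sumF-+ m _ _)

  countV-cong : ∀ {p q : Vtx m r → Bool} → (∀ z → p z ≡ q z) → countV m r p ≡ countV m r q
  countV-cong p≗q = sumF-cong m (λ i → count-cong r (λ a → p≗q (i , a)))

  countV-split : ∀ (p q s : Vtx m r → Bool) → (∀ z → ind (p z) ≡ ind (q z) + ind (s z)) →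
    countV m r p ≡ countV m r q + countV m r s
  countV-split p q s split = begin
    countV m r p                         ≡⟨ countV≡sumV p ⟩
    sumV (ind ∘ p)                       ≡⟨ sumV-cong split ⟩
    sumV (λ z → ind (q z) + ind (s z))   ≡⟨ sumV-+ _ _ ⟩
    sumV (ind ∘ q) + sumV (ind ∘ s)      ≡⟨ sym (cong₂ _+_ (countV≡sumV q) (countV≡sumV s)) ⟩
    countV m r q + countV m r s          ∎

  countV-split₄ : ∀ (p q₁ q₂ q₃ q₄ : Vtx m r → Bool) →
    (∀ z → ind (p z) ≡ ind (q₁ z) + ind (q₂ z) + ind (q₃ z) + ind (q₄ z)) →
    countV m r p ≡ countV m r q₁ + countV m r q₂ + countV m r q₃ + countV m r q₄
  countV-split₄ p q₁ q₂ q₃ q₄ split = begin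
    countV m r p
      ≡⟨ countV≡sumV p ⟩
    sumV (ind ∘ p)
      ≡⟨ sumV-cong split ⟩
    sumV (λ z → ind (q₁ z) + ind (q₂ z) + ind (q₃ z) + ind (q₄ z))
      ≡⟨ sumV-+ _ _ ⟩
    sumV (λ z → ind (q₁ z) + ind (q₂ z) + ind (q₃ z)) + sumV (ind ∘ q₄)
      ≡⟨ cong (_+ sumV (ind ∘ q₄)) (trans (sumV-+ _ _) (cong (_+ sumV (ind ∘ q₃)) (sumV-+ _ _))) ⟩
    sumV (ind ∘ q₁) + sumV (ind ∘ q₂) + sumV (ind ∘ q₃) + sumV (ind ∘ q₄)
      ≡⟨ sym (cong₂ _+_ (cong₂ _+_ (cong₂ _+_ (countV≡sumV q₁) (countV≡sumV q₂)) (countV≡sumV q₃))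
                        (countV≡sumV q₄)) ⟩
    countV m r q₁ + countV m r q₂ + countV m r q₃ + countV m r q₄
      ∎

  countV-within : ∀ (p : Vtx m r → Bool) (j : Fin m) →
    countV m r (λ z → p z ∧ ⌊ proj₁ z ≟F j ⌋) ≡ count r (λ b → p (j , b))
  countV-within p j = trans (sumF-supported m j _ outside) inside
    where
      outside : ∀ i → i ≢ j → count r (λ a → p (i , a) ∧ ⌊ i ≟F j ⌋) ≡ 0
      outside i i≢j with i ≟F j
      ... | yes i≡j = ⊥-elim (i≢j i≡j)
      ... | no  _   = all-false⇒count≡0 r _ (λ a → Bool.∧-zeroʳ (p (i , a)))
      inside : count r (λ a → p (j , a) ∧ ⌊ j ≟F j ⌋) ≡ count r (λ b → p (j , b))
      inside with j ≟F j
      ... | yes _   = count-cong r (λ a → Bool.∧-identityʳ (p (j , a)))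
      ... | no  j≢j = ⊥-elim (j≢j refl)

-- Sign matrices whose rows differ by constants

data Orientation : Set where
  forward backward both : Orientation

sign : Orientation → ℤ
sign forward  = 1ℤ
sign backward = -1ℤ
sign both     = 0ℤ

isForward isBoth : Orientation → Bool
isForward forward = true
isForward _       = false
isBoth both = true
isBoth _    = false

isForward-true : ∀ {s} → isForward s ≡ true → s ≡ forward
isForward-true {forward} _ = refl

isBoth-true : ∀ {s} → isBoth s ≡ true → s ≡ both
isBoth-true {both} _ = refl

neither⇒backward : ∀ {s} → isForward s ≡ false → isBoth s ≡ false → s ≡ backward
neither⇒backward {backward} _ _ = refl

data _⋗_ : Orientation → Orientation → Set where
  forward⋗both  : forward ⋗ both
  both⋗backward : both ⋗ backward

⋗-both : ∀ {s t} → s ⋗ t → isBoth s ≡ true → s ≡ both × t ≡ backward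
⋗-both both⋗backward _ = refl , refl

⋗-forward : ∀ {s t} → s ⋗ t → isBoth s ≡ false → s ≡ forward × t ≡ both
⋗-forward forward⋗both _ = refl , refl

⋗-isBoth : ∀ {s t} → s ⋗ t → isBoth t ≡ not (isBoth s)
⋗-isBoth forward⋗both  = refl
⋗-isBoth both⋗backward = refl

sign-diff≡0 : ∀ s t → sign s -ℤ sign t ≡ 0ℤ → s ≡ t
sign-diff≡0 forward  forward  _ = refl
sign-diff≡0 backward backward _ = refl
sign-diff≡0 both   both   _ = refl
sign-diff≡0 forward  backward ()
sign-diff≡0 forward  both   ()
sign-diff≡0 backward forward  ()
sign-diff≡0 backward both   ()
sign-diff≡0 both   forward  ()
sign-diff≡0 both   backward ()

sign-diff≡1 : ∀ s t → sign s -ℤ sign t ≡ 1ℤ → s ⋗ t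
sign-diff≡1 forward  both   _ = forward⋗both
sign-diff≡1 both   backward _ = both⋗backward
sign-diff≡1 forward  forward  ()
sign-diff≡1 forward  backward ()
sign-diff≡1 backward forward  ()
sign-diff≡1 backward backward ()
sign-diff≡1 backward both   ()
sign-diff≡1 both   forward  ()
sign-diff≡1 both   both   ()

sign-diff≡2 : ∀ s t → sign s -ℤ sign t ≡ pos 2 → s ≡ forward × t ≡ backward
sign-diff≡2 forward  backward _ = refl , refl
sign-diff≡2 forward  forward  ()
sign-diff≡2 forward  both   ()
sign-diff≡2 backward forward  ()
sign-diff≡2 backward backward ()
sign-diff≡2 backward both   ()
sign-diff≡2 both   forward  ()
sign-diff≡2 both   backward ()
sign-diff≡2 both   both   ()

⋗-sign : ∀ {s t} → s ⋗ t → sign s -ℤ sign t ≡ 1ℤ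
⋗-sign forward⋗both  = refl
⋗-sign both⋗backward = refl

Parallel : ∀ {n} (ρ ρ′ : Fin n → Orientation) → Set
Parallel ρ ρ′ = ∀ b b′ → sign (ρ b) -ℤ sign (ρ′ b) ≡ sign (ρ b′) -ℤ sign (ρ′ b′)

module _ {Row : Set} {n : ℕ} (τ : Row → Fin n → Orientation) where

  BothBalanced : Set
  BothBalanced = ∀ a a′ → count n (isBoth ∘ τ a) ≡ count n (isBoth ∘ τ a′)

  -- cases (ii) and (iii) of the theorem for the matrix of orientations between V_i and V_j
  OrientedSplit : Set
  OrientedSplit = Σ (Row → Bool) λ S →
    (∃[ a ] S a ≡ true) × (∃[ a ] S a ≡ false) ×
    (∀ a b → S a ≡ true → τ a b ≡ forward) × (∀ a b → S a ≡ false → τ a b ≡ backward)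

  MixedSplit : Set
  MixedSplit = Σ (Row → Bool) λ S → Σ (Fin n → Bool) λ T →
    (∃[ a ] S a ≡ true) × (∃[ a ] S a ≡ false) ×
    (∃[ b ] T b ≡ true) × (∃[ b ] T b ≡ false) ×
    (∀ a b → S a ≡ true  → T b ≡ true  → τ a b ≡ both) ×
    (∀ a b → S a ≡ false → T b ≡ false → τ a b ≡ both) ×
    (∀ a b → S a ≡ true  → T b ≡ false → τ a b ≡ forward) ×
    (∀ a b → T b ≡ true  → S a ≡ false → τ a b ≡ backward) ×
    (2 * count n (not ∘ T) ≡ n)

module ParallelRows {Row : Set} {n : ℕ} (τ : Row → Fin n → Orientation)
  (parallel : ∀ a a′ → Parallel (τ a) (τ a′)) (balanced : BothBalanced τ) where

  rows-agree : ∀ {a a′ b₀} → τ a b₀ ≡ τ a′ b₀ → ∀ b → τ a b ≡ τ a′ b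
  rows-agree {a} {a′} {b₀} eq b = sign-diff≡0 _ _ (begin
    sign (τ a b) -ℤ sign (τ a′ b)      ≡⟨ parallel a a′ b b₀ ⟩
    sign (τ a b₀) -ℤ sign (τ a′ b₀)    ≡⟨ cong (λ s → sign s -ℤ sign (τ a′ b₀)) eq ⟩
    sign (τ a′ b₀) -ℤ sign (τ a′ b₀)   ≡⟨ ℤ.+-inverseʳ (sign (τ a′ b₀)) ⟩
    0ℤ                                 ∎)

  rows-opposite : ∀ {a a′ b₀} → τ a b₀ ≡ forward → τ a′ b₀ ≡ backward →
    ∀ b → τ a b ≡ forward × τ a′ b ≡ backward
  rows-opposite {a} {a′} {b₀} eq eq′ b =
    sign-diff≡2 _ _ (trans (parallel a a′ b b₀) (cong₂ (λ s t → sign s -ℤ sign t) eq eq′))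

  rows-step : ∀ {a a′ b₀} → τ a b₀ ⋗ τ a′ b₀ → ∀ b → τ a b ⋗ τ a′ b
  rows-step {a} {a′} {b₀} a⋗a′ b = sign-diff≡1 _ _ (trans (parallel a a′ b b₀) (⋗-sign a⋗a′))

  orientedSplit : ∀ {a₀ a₁ b₀} → τ a₀ b₀ ≡ forward → τ a₁ b₀ ≡ backward → OrientedSplit τ
  orientedSplit {a₀} {a₁} {b₀} a₀b₀ a₁b₀ =
    S , (a₀ , cong isForward a₀b₀) , (a₁ , cong isForward a₁b₀) , S⇒forward , ¬S⇒backward
    where
      opposite : ∀ b → τ a₀ b ≡ forward × τ a₁ b ≡ backward
      opposite = rows-opposite a₀b₀ a₁b₀
      no-both : ∀ a b → isBoth (τ a b) ≡ false
      no-both a = count≡0⇒false n _ (trans (balanced a a₀)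
        (all-false⇒count≡0 n _ (λ b → cong isBoth (proj₁ (opposite b)))))
      S : Row → Bool
      S a = isForward (τ a b₀)
      S⇒forward : ∀ a b → S a ≡ true → τ a b ≡ forward
      S⇒forward a b Sa = trans (rows-agree (trans (isForward-true Sa) (sym a₀b₀)) b)
                               (proj₁ (opposite b))
      ¬S⇒backward : ∀ a b → S a ≡ false → τ a b ≡ backward
      ¬S⇒backward a b ¬Sa =
        trans (rows-agree (trans (neither⇒backward ¬Sa (no-both a b₀)) (sym a₁b₀)) b)
              (proj₂ (opposite b))

  mixedSplit : ∀ {hi lo b₀} → τ hi b₀ ⋗ τ lo b₀ → MixedSplit τ
  mixedSplit {hi} {lo} {b₀} hi⋗lo =
    S , T , (hi , Tbᵀ) , (lo , cong isBoth (proj₂ at-bᵀ)) , (bᵀ , Tbᵀ) , (bᶠ , ¬Tbᶠ) ,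
    (λ a b Sa Tb → trans (S⇒hi a Sa b) (proj₁ (⋗-both (step b) Tb))) ,
    (λ a b ¬Sa ¬Tb → trans (¬S⇒lo a ¬Sa b) (proj₂ (⋗-forward (step b) ¬Tb))) ,
    (λ a b Sa ¬Tb → trans (S⇒hi a Sa b) (proj₁ (⋗-forward (step b) ¬Tb))) ,
    (λ a b Tb ¬Sa → trans (¬S⇒lo a ¬Sa b) (proj₂ (⋗-both (step b) Tb))) ,
    half
    where
      step : ∀ b → τ hi b ⋗ τ lo b
      step = rows-step hi⋗lo
      T : Fin n → Bool
      T b = isBoth (τ hi b)
      halves : count n T ≡ count n (not ∘ T)
      halves = trans (balanced hi lo) (count-cong n (⋗-isBoth ∘ step))
      half : 2 * count n (not ∘ T) ≡ n
      half = begin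
        count n (not ∘ T) + (count n (not ∘ T) + 0) ≡⟨ cong (count n (not ∘ T) +_) (ℕ.+-identityʳ _) ⟩
        count n (not ∘ T) + count n (not ∘ T)       ≡⟨ cong (_+ count n (not ∘ T)) (sym halves) ⟩
        count n T + count n (not ∘ T)               ≡⟨ count-complement n T ⟩
        n                                           ∎
      n≢0 : n ≢ 0
      n≢0 n≡0 = ¬Fin0 (subst Fin n≡0 b₀)
      T≢0 : count n T ≢ 0
      T≢0 T≡0 = n≢0 (trans (sym (count-complement n T)) (cong₂ _+_ T≡0 (trans (sym halves) T≡0)))
      ¬T≢0 : count n (not ∘ T) ≢ 0
      ¬T≢0 ¬T≡0 = T≢0 (trans halves ¬T≡0)
      bᵀ bᶠ : Fin n
      bᵀ = proj₁ (count≢0⇒∃ n T T≢0)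
      bᶠ = proj₁ (count≢0⇒∃ n (not ∘ T) ¬T≢0)
      Tbᵀ : T bᵀ ≡ true
      Tbᵀ = proj₂ (count≢0⇒∃ n T T≢0)
      ¬Tbᶠ : T bᶠ ≡ false
      ¬Tbᶠ = trans (sym (Bool.not-involutive (T bᶠ))) (cong not (proj₂ (count≢0⇒∃ n (not ∘ T) ¬T≢0)))
      at-bᵀ : τ hi bᵀ ≡ both × τ lo bᵀ ≡ backward
      at-bᵀ = ⋗-both (step bᵀ) Tbᵀ
      at-bᶠ : τ hi bᶠ ≡ forward × τ lo bᶠ ≡ both
      at-bᶠ = ⋗-forward (step bᶠ) ¬Tbᶠ
      S : Row → Bool
      S a = isBoth (τ a bᵀ)
      S⇒hi : ∀ a → S a ≡ true → ∀ b → τ a b ≡ τ hi b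
      S⇒hi a Sa = rows-agree (trans (isBoth-true Sa) (sym (proj₁ at-bᵀ)))
      -- a row that is forward at bᵀ would be opposite to the lower row, which is both at bᶠ
      ¬S⇒lo : ∀ a → S a ≡ false → ∀ b → τ a b ≡ τ lo b
      ¬S⇒lo a ¬Sa with τ a bᵀ in abᵀ
      ... | backward = rows-agree (trans abᵀ (sym (proj₂ at-bᵀ)))
      ... | forward  with () ← trans (sym (proj₂ at-bᶠ))
                                 (proj₂ (rows-opposite abᵀ (proj₂ at-bᵀ) bᶠ))

  distinct-rows : ∀ {a a′ b} → τ a b ≢ τ a′ b → OrientedSplit τ ⊎ MixedSplit τ
  distinct-rows {a} {a′} {b} ab≢a′b with τ a b in ab | τ a′ b in a′b
  ... | forward  | backward = inj₁ (orientedSplit ab a′b)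
  ... | backward | forward  = inj₁ (orientedSplit a′b ab)
  ... | forward  | both     = inj₂ (mixedSplit (subst₂ _⋗_ (sym ab) (sym a′b) forward⋗both))
  ... | both     | backward = inj₂ (mixedSplit (subst₂ _⋗_ (sym ab) (sym a′b) both⋗backward))
  ... | both     | forward  = inj₂ (mixedSplit (subst₂ _⋗_ (sym a′b) (sym ab) forward⋗both))
  ... | backward | both     = inj₂ (mixedSplit (subst₂ _⋗_ (sym a′b) (sym ab) both⋗backward))
  ... | forward  | forward  = ⊥-elim (ab≢a′b refl)
  ... | backward | backward = ⊥-elim (ab≢a′b refl)
  ... | both     | both     = ⊥-elim (ab≢a′b refl)

potential⇒parallel : ∀ {Row : Set} {n} (τ : Row → Fin n → Orientation)
  (f : Row → ℤ) (g : Fin n → ℤ) (δ : ℤ) → (∀ a b → f a -ℤ g b ≡ sign (τ a b) *ℤ δ) →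
  δ ≢ 0ℤ → ∀ a a′ → Parallel (τ a) (τ a′)
potential⇒parallel τ f g δ potential δ≢0 a a′ b b′ =
  ℤ.*-cancelʳ-≡ _ _ δ {{≢-nonZero δ≢0}} (trans (row-gap b) (sym (row-gap b′)))
  where
    row-gap : ∀ b → (sign (τ a b) -ℤ sign (τ a′ b)) *ℤ δ ≡ f a -ℤ f a′
    row-gap b = begin
      (sign (τ a b) -ℤ sign (τ a′ b)) *ℤ δ         ≡⟨ distrib (sign (τ a b)) (sign (τ a′ b)) δ ⟩
      sign (τ a b) *ℤ δ -ℤ sign (τ a′ b) *ℤ δ      ≡⟨ sym (cong₂ _-ℤ_ (potential a b) (potential a′ b)) ⟩
      (f a -ℤ g b) -ℤ (f a′ -ℤ g b)                ≡⟨ cancel (f a) (f a′) (g b) ⟩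
      f a -ℤ f a′                                  ∎
      where
        distrib : ∀ x y d → (x -ℤ y) *ℤ d ≡ x *ℤ d -ℤ y *ℤ d
        distrib = solve-∀ℤ
        cancel : ∀ x x′ y → (x -ℤ y) -ℤ (x′ -ℤ y) ≡ x -ℤ x′
        cancel = solve-∀ℤ

nonconstant-potential : ∀ {Row : Set} {n} (τ : Row → Fin n → Orientation)
  (f : Row → ℤ) (g : Fin n → ℤ) (δ : ℤ) → (∀ a b → f a -ℤ g b ≡ sign (τ a b) *ℤ δ) →
  BothBalanced τ → ∀ {a a′} → Fin n → f a ≢ f a′ → OrientedSplit τ ⊎ MixedSplit τ
nonconstant-potential τ f g δ potential balanced {a} {a′} b fa≢fa′ =
  ParallelRows.distinct-rows τ (potential⇒parallel τ f g δ potential δ≢0) balanced rows-differ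
  where
    same-gap⇒equal : f a -ℤ g b ≡ f a′ -ℤ g b → f a ≡ f a′
    same-gap⇒equal eq = trans (shift (f a) (g b)) (trans (cong (_+ℤ g b) eq) (sym (shift (f a′) (g b))))
      where
        shift : ∀ x y → x ≡ (x -ℤ y) +ℤ y
        shift = solve-∀ℤ
    δ≢0 : δ ≢ 0ℤ
    δ≢0 δ≡0 = fa≢fa′ (same-gap⇒equal (trans (vanishes a) (sym (vanishes a′))))
      where
        vanishes : ∀ a → f a -ℤ g b ≡ 0ℤ
        vanishes a = trans (potential a b) (trans (cong (sign (τ a b) *ℤ_) δ≡0) (ℤ.*-zeroʳ (sign (τ a b))))
    rows-differ : τ a b ≢ τ a′ b
    rows-differ eq = fa≢fa′ (same-gap⇒equal
      (trans (potential a b) (trans (cong (λ s → sign s *ℤ δ) eq) (sym (potential a′ b)))))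

constant⊎nonconstant : ∀ {n} (F : Fin n → ℕ) → (∃[ c ] ∀ a → F a ≡ c) ⊎ (∃₂ λ a a′ → F a ≢ F a′)
constant⊎nonconstant {zero}  F = inj₁ (0 , λ ())
constant⊎nonconstant {suc n} F with all? (λ a → F a ℕ.≟ F zero)
... | yes all≡ = inj₁ (F zero , all≡)
... | no ¬all≡ = let a , Fa≢ = ¬∀⟶∃¬ (suc n) _ (λ a → F a ℕ.≟ F zero) ¬all≡ in inj₂ (a , zero , Fa≢)

orientation : Bool → Bool → Orientation
orientation true  false = forward
orientation false true  = backward
orientation true  true  = both
orientation false false = both

orientation-forward : ∀ {p q} → orientation p q ≡ forward → (p ∧ not q) ≡ true
orientation-forward {true}  {false} _ = refl
orientation-forward {true}  {true}  ()
orientation-forward {false} {true}  ()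
orientation-forward {false} {false} ()

orientation-backward : ∀ {p q} → orientation p q ≡ backward → (q ∧ not p) ≡ true
orientation-backward {false} {true}  _ = refl
orientation-backward {true}  {true}  ()
orientation-backward {true}  {false} ()
orientation-backward {false} {false} ()

isBoth-orientation : ∀ {p q} → (p ∨ q) ≡ true → isBoth (orientation p q) ≡ (p ∧ q)
isBoth-orientation {true}  {true}  _ = refl
isBoth-orientation {true}  {false} _ = refl
isBoth-orientation {false} {true}  _ = refl

orientation-both : ∀ {p q} → (p ∨ q) ≡ true → orientation p q ≡ both → (p ∧ q) ≡ true
orientation-both p∨q eq = trans (sym (isBoth-orientation p∨q)) (cong isBoth eq)

balance⇒difference : ∀ a b u v → a +ℤ u ≡ b +ℤ v → a -ℤ b ≡ v -ℤ u
balance⇒difference a b u v eq = begin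
  a -ℤ b                 ≡⟨ shift a b u ⟩
  (a +ℤ u) -ℤ (b +ℤ u)   ≡⟨ cong (_-ℤ (b +ℤ u)) eq ⟩
  (b +ℤ v) -ℤ (b +ℤ u)   ≡⟨ unshift b u v ⟩
  v -ℤ u                 ∎
  where
    shift : ∀ a b u → a -ℤ b ≡ (a +ℤ u) -ℤ (b +ℤ u)
    shift = solve-∀ℤ
    unshift : ∀ b u v → (b +ℤ v) -ℤ (b +ℤ u) ≡ v -ℤ u
    unshift = solve-∀ℤ

swap-difference : ∀ (w : Bool → Bool → ℤ) p q →
  w q p -ℤ w p q ≡ sign (orientation p q) *ℤ (w false true -ℤ w true false)
swap-difference w true  false = sym (ℤ.*-identityˡ _)
swap-difference w false true  = negate (w false true) (w true false)
  where
    negate : ∀ x y → y -ℤ x ≡ -1ℤ *ℤ (x -ℤ y)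
    negate = solve-∀ℤ
swap-difference w true  true  = ℤ.+-inverseʳ (w true true)
swap-difference w false false = ℤ.+-inverseʳ (w false false)

ind-split : ∀ p q → ind p ≡ ind (p ∧ not q) + ind (p ∧ q)
ind-split true  true  = refl
ind-split true  false = refl
ind-split false _     = refl

ind-partition : ∀ {P : Set} (P? : Dec P) c p q →
  (P → p ≡ false × q ≡ false) → (¬ P → (p ∨ q) ≡ true) →
  ind c ≡ ind (c ∧ ⌊ P? ⌋) + ind (c ∧ (p ∧ not q)) + ind (c ∧ (p ∧ q)) + ind (c ∧ (q ∧ not p))
ind-partition _        false _     _     _    _    = refl
ind-partition (yes P)  true  p     q     none _    with none P
... | refl , refl = refl
ind-partition (no _)   true  true  true  _    _    = refl
ind-partition (no _)   true  true  false _    _    = refl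
ind-partition (no _)   true  false true  _    _    = refl
ind-partition (no ¬P)  true  false false _    some with () ← some ¬P

-- Degree counts in a team semicomplete multipartite digraph

module _ {m r : ℕ} (arc : Digraph m r) where

  orientationOf : Vtx m r → Vtx m r → Orientation
  orientationOf x y = orientation (arc x y) (arc y x)

  mutualTo : Vtx m r → Fin m → ℕ
  mutualTo x j = count r (λ b → Ed arc x (j , b))

  arcDeg mutualDeg : Vtx m r → ℕ
  arcDeg x = countV m r (Ar arc x)
  mutualDeg x = countV m r (Ed arc x)

  A₀A₀ A₁A₀ A₁A₁ : Vtx m r → Vtx m r → ℕ
  A₀A₀ = prod arc 0F 0F
  A₁A₀ = prod arc 1F 0F
  A₁A₁ = prod arc 1F 1F

  Ed-sym : ∀ x y → Ed arc x y ≡ Ed arc y x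
  Ed-sym x y = Bool.∧-comm (arc x y) (arc y x)

  A₀A₀-sym : ∀ x y → A₀A₀ x y ≡ A₀A₀ y x
  A₀A₀-sym x y = countV-cong (λ z →
    trans (Bool.∧-comm (Ed arc x z) (Ed arc z y)) (cong₂ _∧_ (Ed-sym z y) (Ed-sym x z)))

  mutualDeg≡A₀A₀ : ∀ x → mutualDeg x ≡ A₀A₀ x x
  mutualDeg≡A₀A₀ x = countV-cong (λ z →
    sym (trans (cong (Ed arc x z ∧_) (Ed-sym z x)) (Bool.∧-idem (Ed arc x z))))

  ≟V-refl : ∀ (x : Vtx m r) → (x ≟V x) ≡ true
  ≟V-refl (i , a) with i ≟F i | a ≟F a
  ... | yes _   | yes _   = refl
  ... | no  i≢i | _       = ⊥-elim (i≢i refl)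
  ... | yes _   | no  a≢a = ⊥-elim (a≢a refl)

  ≟V-distinct : ∀ {x y : Vtx m r} → proj₁ x ≢ proj₁ y → (x ≟V y) ≡ false
  ≟V-distinct {i , _} {j , _} i≢j with i ≟F j
  ... | yes i≡j = ⊥-elim (i≢j i≡j)
  ... | no  _   = refl

  countV-by-relation : IsTeamSMD m r arc → ∀ (c : Vtx m r → Bool) y →
    countV m r c ≡ count r (λ b → c (proj₁ y , b)) + countV m r (λ z → c z ∧ Ar arc z y)
                   + countV m r (λ z → c z ∧ Ed arc z y) + countV m r (λ z → c z ∧ Ar arc y z)
  countV-by-relation (_ , _ , no-arc , adjacent) c y =
    trans (countV-split₄ c _ _ _ _ (λ z →
            ind-partition (proj₁ z ≟F proj₁ y) (c z) (arc z y) (arc y z)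
              (λ z~y → no-arc z y z~y , no-arc y z (sym z~y)) (adjacent z y)))
          (cong₂ _+_ (cong₂ _+_ (cong₂ _+_ (countV-within c (proj₁ y)) refl) refl) refl)

  prod-determined : IsDoublyRegular arc → ∀ i j →
    Σ (Bool → Bool → Bool → ℤ) λ v → ∀ x y → pos (prod arc i j x y) ≡ v (x ≟V y) (arc x y) (arc y x)
  prod-determined (_ , t , α , β , γ , η , identity) i j =
    (λ e p q → t *ℤ b2z arc (δ0 arc i j ∧ e)
               +ℤ α (idx arc i j) *ℤ b2z arc (p ∧ not q)
               +ℤ β (idx arc i j) *ℤ b2z arc (q ∧ not p)
               +ℤ γ (idx arc i j) *ℤ b2z arc (p ∧ q)
               +ℤ η (idx arc i j) *ℤ b2z arc (not e ∧ not p ∧ not q))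
    , identity i j

  -- the right-hand side of the identity for A_i A_j depends on i + j only
  A₀A₁≡A₁A₀ : IsDoublyRegular arc → ∀ x y → prod arc 0F 1F x y ≡ A₁A₀ x y
  A₀A₁≡A₁A₀ (_ , _ , _ , _ , _ , _ , identity) x y =
    ℤ.+-injective (trans (identity 0F 1F x y) (sym (identity 1F 0F x y)))

  module _ (team : IsTeamSMD m r arc) (dr : IsDoublyRegular arc) where

    private
      no-arc : ∀ x y → proj₁ x ≡ proj₁ y → arc x y ≡ false
      no-arc = proj₁ (proj₂ (proj₂ team))
      k : ℕ
      k = proj₁ (proj₁ dr)
      out-degree : ∀ x → countV m r (arc x) ≡ k
      out-degree = proj₁ (proj₂ (proj₁ dr))

    mutualDeg-constant : ∀ x y → mutualDeg x ≡ mutualDeg y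
    mutualDeg-constant x y =
      trans (mutualDeg≡A₀A₀ x) (trans (ℤ.+-injective (trans (diagonal x) (sym (diagonal y))))
                                      (sym (mutualDeg≡A₀A₀ y)))
      where
        v : Bool → Bool → Bool → ℤ
        v = proj₁ (prod-determined dr 0F 0F)
        diagonal : ∀ x → pos (A₀A₀ x x) ≡ v true false false
        diagonal x = trans (proj₂ (prod-determined dr 0F 0F) x x)
          (cong₂ (λ e p → v e p p) (≟V-refl x) (no-arc x x refl))

    arcDeg-constant : ∀ x y → arcDeg x ≡ arcDeg y
    arcDeg-constant x y = ℕ.+-cancelʳ-≡ (mutualDeg x) (arcDeg x) (arcDeg y)
      (trans (degree x) (trans (sym (degree y)) (cong (arcDeg y +_) (mutualDeg-constant y x))))
      where
        degree : ∀ x → arcDeg x + mutualDeg x ≡ k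
        degree x = trans (sym (countV-split (arc x) (Ar arc x) (Ed arc x) (λ z → ind-split (arc x z) (arc z x))))
                         (out-degree x)

    mutualTo-symmetric : ∀ x y → mutualTo x (proj₁ y) ≡ mutualTo y (proj₁ x)
    mutualTo-symmetric x y = cancel (begin
      mutualTo x (proj₁ y) + A₁A₀ x y + A₀A₀ x y + A₁A₀ y x
        ≡⟨ sym (split x y) ⟩
      mutualDeg x
        ≡⟨ mutualDeg-constant x y ⟩
      mutualDeg y
        ≡⟨ split y x ⟩
      mutualTo y (proj₁ x) + A₁A₀ y x + A₀A₀ y x + A₁A₀ x y
        ≡⟨ cong (λ w → mutualTo y (proj₁ x) + A₁A₀ y x + w + A₁A₀ x y) (A₀A₀-sym y x) ⟩
      mutualTo y (proj₁ x) + A₁A₀ y x + A₀A₀ x y + A₁A₀ x y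
        ∎)
      where
        split : ∀ x y → mutualDeg x ≡ mutualTo x (proj₁ y) + A₁A₀ x y + A₀A₀ x y + A₁A₀ y x
        split x y = trans (countV-by-relation team (Ed arc x) y)
          (cong₂ (λ u w → mutualTo x (proj₁ y) + u + A₀A₀ x y + w) (A₀A₁≡A₁A₀ dr x y)
                 (countV-cong (λ z → trans (Bool.∧-comm (Ed arc x z) (Ar arc y z))
                                           (cong (Ar arc y z ∧_) (Ed-sym x z)))))
        cancel : ∀ {a b u v w} → a + u + w + v ≡ b + v + w + u → a ≡ b
        cancel {a} {b} {u} {v} {w} eq = ℕ.+-cancelʳ-≡ (u + w + v) a b
          (trans (regroup a u v w) (trans eq (sym (regroup′ b u v w))))
          where
            regroup : ∀ a u v w → a + (u + w + v) ≡ a + u + w + v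
            regroup = solve-∀
            regroup′ : ∀ b u v w → b + (u + w + v) ≡ b + v + w + u
            regroup′ = solve-∀

    outTo-balance : ∀ x y → outTo arc x (proj₁ y) + (A₁A₁ x y + A₁A₀ x y)
                          ≡ outTo arc y (proj₁ x) + (A₁A₁ y x + A₁A₀ y x)
    outTo-balance x y = ℕ.+-cancelʳ-≡ (common x y) _ _ (begin
      outTo arc x (proj₁ y) + (A₁A₁ x y + A₁A₀ x y) + common x y
        ≡⟨ cong (_+ common x y) (sym (ℕ.+-assoc (outTo arc x (proj₁ y)) _ _)) ⟩
      outTo arc x (proj₁ y) + A₁A₁ x y + A₁A₀ x y + common x y
        ≡⟨ sym (countV-by-relation team (Ar arc x) y) ⟩
      arcDeg x
        ≡⟨ arcDeg-constant x y ⟩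
      arcDeg y
        ≡⟨ countV-by-relation team (Ar arc y) x ⟩
      outTo arc y (proj₁ x) + A₁A₁ y x + A₁A₀ y x + common y x
        ≡⟨ cong₂ _+_ (ℕ.+-assoc (outTo arc y (proj₁ x)) _ _)
                     (countV-cong (λ z → Bool.∧-comm (Ar arc y z) (Ar arc x z))) ⟩
      outTo arc y (proj₁ x) + (A₁A₁ y x + A₁A₀ y x) + common x y
        ∎)
      where
        common : Vtx m r → Vtx m r → ℕ
        common x y = countV m r (λ z → Ar arc x z ∧ Ar arc y z)

    outTo-difference : ∃[ δ ] ∀ x y → proj₁ x ≢ proj₁ y →
      pos (outTo arc x (proj₁ y)) -ℤ pos (outTo arc y (proj₁ x)) ≡ sign (orientationOf x y) *ℤ δ
    outTo-difference = w false true -ℤ w true false , difference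
      where
        v : Fin 2 → Fin 2 → Bool → Bool → Bool → ℤ
        v k l = proj₁ (prod-determined dr k l)
        between-parts : ∀ k l {x y} → proj₁ x ≢ proj₁ y → pos (prod arc k l x y) ≡ v k l false (arc x y) (arc y x)
        between-parts k l {x} {y} x≁y =
          trans (proj₂ (prod-determined dr k l) x y) (cong (λ e → v k l e (arc x y) (arc y x)) (≟V-distinct x≁y))
        w : Bool → Bool → ℤ
        w p q = v 1F 1F false p q +ℤ v 1F 0F false p q
        A₁A₁+A₁A₀≡w : ∀ x y → proj₁ x ≢ proj₁ y → pos (A₁A₁ x y + A₁A₀ x y) ≡ w (arc x y) (arc y x)
        A₁A₁+A₁A₀≡w x y x≁y = cong₂ _+ℤ_ (between-parts 1F 1F x≁y) (between-parts 1F 0F x≁y)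
        difference : ∀ x y → proj₁ x ≢ proj₁ y →
          pos (outTo arc x (proj₁ y)) -ℤ pos (outTo arc y (proj₁ x)) ≡ sign (orientationOf x y) *ℤ (w false true -ℤ w true false)
        difference x y x≁y = begin
          pos (outTo arc x (proj₁ y)) -ℤ pos (outTo arc y (proj₁ x))
            ≡⟨ balance⇒difference (pos (outTo arc x (proj₁ y))) (pos (outTo arc y (proj₁ x)))
                                  (pos (A₁A₁ x y + A₁A₀ x y)) (pos (A₁A₁ y x + A₁A₀ y x))
                                  (cong pos (outTo-balance x y)) ⟩
          pos (A₁A₁ y x + A₁A₀ y x) -ℤ pos (A₁A₁ x y + A₁A₀ x y)
            ≡⟨ cong₂ _-ℤ_ (A₁A₁+A₁A₀≡w y x (x≁y ∘ sym)) (A₁A₁+A₁A₀≡w x y x≁y) ⟩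
          w (arc y x) (arc x y) -ℤ w (arc x y) (arc y x)
            ≡⟨ swap-difference w (arc x y) (arc y x) ⟩
          sign (orientationOf x y) *ℤ (w false true -ℤ w true false)
            ∎

module _ {m r : ℕ} {arc : Digraph m r} (team : IsTeamSMD m r arc) {i j : Fin m} (i≢j : i ≢ j) where

  private
    τ : Fin r → Fin r → Orientation
    τ a b = orientationOf arc (i , a) (j , b)

    adjacent : ∀ a b → (arc (i , a) (j , b) ∨ arc (j , b) (i , a)) ≡ true
    adjacent a b = proj₂ (proj₂ (proj₂ team)) (i , a) (j , b) i≢j

  orientedSplit⇒Alt2 : OrientedSplit τ → Alt2 arc i j
  orientedSplit⇒Alt2 (S , S-true , S-false , S⇒forward , ¬S⇒backward) =
    S , S-true , S-false ,
    (λ a b Sa → orientation-forward (S⇒forward a b Sa)) ,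
    (λ a b ¬Sa → orientation-backward (¬S⇒backward a b ¬Sa))

  mixedSplit⇒Alt3 : MixedSplit τ → Alt3 arc i j
  mixedSplit⇒Alt3 (S , T , S-true , S-false , T-true , T-false , both₁ , both₂ , fwd , bwd , half) =
    S , T , S-true , S-false , T-true , T-false ,
    (λ a b Sa Tb → orientation-both (adjacent a b) (both₁ a b Sa Tb)) ,
    (λ a b ¬Sa ¬Tb → orientation-both (adjacent a b) (both₂ a b ¬Sa ¬Tb)) ,
    (λ a b Sa ¬Tb → orientation-forward (fwd a b Sa ¬Tb)) ,
    (λ a b Tb ¬Sa → orientation-backward (bwd a b Tb ¬Sa)) ,
    half

  module _ (dr : IsDoublyRegular arc) where

    both-balanced : BothBalanced τ
    both-balanced a a′ = begin
      count r (isBoth ∘ τ a)    ≡⟨ both≡mutualTo a ⟩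
      mutualTo arc (i , a) j    ≡⟨ mutualTo-symmetric arc team dr (i , a) (j , a) ⟩
      mutualTo arc (j , a) i    ≡⟨ sym (mutualTo-symmetric arc team dr (i , a′) (j , a)) ⟩
      mutualTo arc (i , a′) j   ≡⟨ sym (both≡mutualTo a′) ⟩
      count r (isBoth ∘ τ a′)   ∎
      where
        both≡mutualTo : ∀ a → count r (isBoth ∘ τ a) ≡ mutualTo arc (i , a) j
        both≡mutualTo a = count-cong r (λ b → isBoth-orientation (adjacent a b))

    nonconstant-outTo : ∀ {a a′} → outTo arc (i , a) j ≢ outTo arc (i , a′) j → Alt2 arc i j ⊎ Alt3 arc i j
    nonconstant-outTo {a} outTo≢ =
      -- V_i and V_j both have r vertices, so a also names a column
      Sum.map orientedSplit⇒Alt2 mixedSplit⇒Alt3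
        (nonconstant-potential τ f g δ potential both-balanced a (outTo≢ ∘ ℤ.+-injective))
      where
        f g : Fin r → ℤ
        f a = pos (outTo arc (i , a) j)
        g b = pos (outTo arc (j , b) i)
        δ : ℤ
        δ = proj₁ (outTo-difference arc team dr)
        potential : ∀ a b → f a -ℤ g b ≡ sign (τ a b) *ℤ δ
        potential a b = proj₂ (outTo-difference arc team dr) (i , a) (j , b) i≢j

lemma3p8 : ∀ (m r : ℕ) (arc : Digraph m r) →
    IsTeamSMD m r arc → IsDoublyRegular arc →
    ∀ (i j : Fin m) → i ≢ j →
      Alt1 arc i j ⊎ Alt2 arc i j ⊎ Alt3 arc i j
lemma3p8 m r arc team dr i j i≢j with constant⊎nonconstant (λ a → outTo arc (i , a) j)
... | inj₁ constant         = inj₁ constant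
... | inj₂ (_ , _ , outTo≢) = inj₂ (nonconstant-outTo team i≢j dr outTo≢)
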